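{- Let $\mathcal{G}$ be the simplicial clique sum of graphs $G_1$ and $G_2$, let $V(G_1)\cap V(G_2)=\{v_1,\dots,v_c\}$ with $c=|V(G_1)\cap V(G_2)|$, and for each $i$ let $l_i$ be the number of maximal independent sets of $G_1$ containing $v_i$ and $m_i$ the number of maximal independent sets of $G_2$ containing $v_i$. Then $\mathcal{G}$ has exactly $\sum_{i=1}^c l_i m_i$ maximal independent sets.
   Context: All graphs are finite, simple, connected and undirected. A maximal independent set is an independent set not properly contained in another independent set. A vertex $v$ is simplicial if its closed neighborhood $N[v]$ is a maximal clique; a simplicial clique is a maximal clique containing at least one simplicial vertex, and $\mathcal{C}(G)$ is the set of simplicial cliques of $G$. If $G_1,G_2$ are subgraphs of a graph $\mathcal{G}$ with $\mathcal{C}(G_1),\mathcal{C}(G_2)$ nonempty, $\mathcal{G}$ is the simplicial clique sum (SCS) of $G_1$ and $G_2$ if $V(G_1)\cup V(G_2)=V(\mathcal{G})$, $E(G_1)\cup E(G_2)=E(\mathcal{G})$, and $V(G_1)\cap V(G_2)$ is a simplicial clique of each of $G_1$, $G_2$ and $\mathcal{G}$. -}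

module Defs where

open import Data.Nat using (ℕ; _*_)
open import Data.Fin using (Fin)
open import Data.Fin.Subset using (Subset; _⊆_) renaming (_∈_ to _∈ₛ_)
open import Data.List using (List; length)
open import Data.List.Relation.Unary.Unique.Propositional using (Unique)
open import Data.List.Membership.Propositional using () renaming (_∈_ to _∈ₗ_)
open import Data.Product using (Σ; ∃; _×_; _,_)
open import Data.Sum using (_⊎_)
open import Data.Unit using (⊤)
open import Relation.Binary.PropositionalEquality using (_≡_; _≢_)
open import Relation.Nullary using (¬_)
open import Function.Bundles using (_⇔_)

record Graph (n : ℕ) : Set₁ where
  field
    Adj    : Fin n → Fin n → Set
    sym    : ∀ {u v} → Adj u v → Adj v u
    irrefl : ∀ {v} → ¬ Adj v v

record Subgraph {n : ℕ} (G : Graph n) : Set₁ where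
  field
    V           : Fin n → Set
    E           : Fin n → Fin n → Set
    E-sym       : ∀ {u v} → E u v → E v u
    E⊆Adj       : ∀ {u v} → E u v → Graph.Adj G u v
    E-endpoints : ∀ {u v} → E u v → V u × V v

open Subgraph public

whole : ∀ {n} (G : Graph n) → Subgraph G
whole G = record
  { V = λ _ → ⊤
  ; E = Graph.Adj G
  ; E-sym = Graph.sym G
  ; E⊆Adj = λ e → e
  ; E-endpoints = λ _ → _ , _
  }

VPred : ℕ → Set₁
VPred n = Fin n → Set

_⊆ₚ_ : ∀ {n} → VPred n → VPred n → Set
P ⊆ₚ Q = ∀ x → P x → Q x

data Walk {n} {G : Graph n} (H : Subgraph G) : Fin n → Fin n → Set where
  here : ∀ {v} → Walk H v v
  step : ∀ {u w v} → E H u w → Walk H w v → Walk H u v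

Connected : ∀ {n} {G : Graph n} → Subgraph G → Set
Connected H = ∀ u v → V H u → V H v → Walk H u v

IsClique : ∀ {n} {G : Graph n} → Subgraph G → VPred n → Set
IsClique H K = (K ⊆ₚ V H) × (∀ u v → K u → K v → u ≢ v → E H u v)

IsMaximalClique : ∀ {n} {G : Graph n} → Subgraph G → VPred n → Set₁
IsMaximalClique H K = IsClique H K × (∀ K' → IsClique H K' → K ⊆ₚ K' → K' ⊆ₚ K)

ClosedNbhd : ∀ {n} {G : Graph n} → Subgraph G → Fin n → VPred n
ClosedNbhd H v u = (u ≡ v) ⊎ E H v u

IsSimplicial : ∀ {n} {G : Graph n} → Subgraph G → Fin n → Set₁
IsSimplicial H v = V H v × IsMaximalClique H (ClosedNbhd H v)

IsSimplicialClique : ∀ {n} {G : Graph n} → Subgraph G → VPred n → Set₁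
IsSimplicialClique {n} H K = IsMaximalClique H K × Σ (Fin n) (λ v → K v × IsSimplicial H v)

HasSimplicialClique : ∀ {n} {G : Graph n} → Subgraph G → Set₁
HasSimplicialClique H = Σ (VPred _) (λ K → IsSimplicialClique H K)

Inter : ∀ {n} {G : Graph n} → Subgraph G → Subgraph G → VPred n
Inter G₁ G₂ x = V G₁ x × V G₂ x

IsSCS : ∀ {n} (G : Graph n) (G₁ G₂ : Subgraph G) → Set₁
IsSCS G G₁ G₂ =
    HasSimplicialClique G₁
  × HasSimplicialClique G₂
  × (∀ x → V G₁ x ⊎ V G₂ x)
  × (∀ u v → Graph.Adj G u v ⇔ (E G₁ u v ⊎ E G₂ u v))
  × IsSimplicialClique G₁ (Inter G₁ G₂)
  × IsSimplicialClique G₂ (Inter G₁ G₂)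
  × IsSimplicialClique (whole G) (Inter G₁ G₂)

IsIndependent : ∀ {n} {G : Graph n} → Subgraph G → Subset n → Set
IsIndependent H S = (∀ v → v ∈ₛ S → V H v) × (∀ u v → u ∈ₛ S → v ∈ₛ S → ¬ E H u v)

IsMaximalIndependent : ∀ {n} {G : Graph n} → Subgraph G → Subset n → Set
IsMaximalIndependent H S = IsIndependent H S × (∀ T → IsIndependent H T → S ⊆ T → T ⊆ S)

-- "exactly k subsets satisfy P": a duplicate-free list enumerating exactly them has length k
NumberOf : ∀ {n} → (Subset n → Set) → ℕ → Set
NumberOf {n} P k = Σ (List (Subset n)) (λ xs → Unique xs × (∀ S → (S ∈ₗ xs) ⇔ P S) × length xs ≡ k)

NumMIS : ∀ {n} {G : Graph n} → Subgraph G → ℕ → Set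
NumMIS H k = NumberOf (IsMaximalIndependent H) k

NumMISContaining : ∀ {n} {G : Graph n} → Subgraph G → Fin n → ℕ → Set
NumMISContaining H v k = NumberOf (λ S → IsMaximalIndependent H S × v ∈ₛ S) k

module Submission where

-- Let 𝒢 be the simplicial clique sum of G₁ and G₂ along K = V(G₁) ∩ V(G₂).
-- For v ∈ K, a maximal independent set (MIS) S₁ of G₁ containing v and an
-- MIS S₂ of G₂ containing v form a "glued pair"; the map (v, S₁, S₂) ↦ S₁ ∪ S₂
-- is a bijection from glued pairs onto the MIS of 𝒢:
--   * S₁ ∪ S₂ is an MIS of 𝒢, and S₁, S₂, v are recovered from S₁ ∪ S₂ as its
--     traces on V(G₁), V(G₂) and K, because K is a clique on both sides;
--   * every MIS S of 𝒢 meets K (it dominates the simplicial vertex s of 𝒢,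
--     whose closed neighbourhood lies in K), and for u ∈ S ∩ K the traces
--     S ∩ V(G₁), S ∩ V(G₂) form a glued pair through u with union S.
-- Forming traces needs V(Gᵢ) decidable; since membership in the final list is
-- decidable, double-negated decidability (true constructively on Fin n) suffices.

open import Defs
open import Data.Nat using (ℕ; zero; suc; _+_; _*_)
open import Data.Fin using (Fin; zero; suc)
open import Data.Fin.Properties using (_≟_)
open import Data.Fin.Subset using (Subset; _∪_; _∩_; ⁅_⁆; ⊤) renaming (_∈_ to _∈ₛ_; _⊆_ to _⊆ₛ_)
open import Data.Fin.Subset.Properties using (x∈p∪q⁻; x∈p∪q⁺; x∈p∩q⁻; x∈p∩q⁺; x∈⁅x⁆; x∈⁅y⁆⇒x≡y; p⊆p∪q; ∪-comm; ⊆-antisym; ⊆⊤; ∩-identityʳ; ∩-distribˡ-∪) renaming (_∈?_ to _∈ₛ?_)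
import Data.Bool as Bool
open import Data.Vec using (tabulate)
open import Data.Vec.Properties using (lookup∘tabulate; lookup⇒[]=; []=⇒lookup; ≡-dec)
open import Data.List using (List; []; _∷_; _++_; map; length; concatMap; cartesianProductWith)
open import Data.List.Properties using (length-++; length-map)
open import Data.Nat.ListAction using (sum)
open import Data.List.Relation.Unary.Any using (here; there; any?)
import Data.List.Relation.Unary.All as All
import Data.List.Relation.Unary.All.Properties as All
open import Data.List.Relation.Unary.Unique.Propositional using (Unique; []; _∷_)
open import Data.List.Relation.Unary.Unique.Propositional.Properties using (++⁺)
open import Data.List.Relation.Binary.Disjoint.Propositional using (Disjoint)
open import Data.List.Membership.Propositional using (find; lose) renaming (_∈_ to _∈ₗ_)
open import Data.List.Membership.Propositional.Properties using (∈-map⁻; ∈-concatMap⁺; ∈-concatMap⁻; ∈-cartesianProductWith⁺; ∈-cartesianProductWith⁻)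
import Data.List.Membership.DecPropositional as DecMembership
open import Data.Product using (Σ; _×_; _,_; proj₁; proj₂)
open import Data.Sum using (_⊎_; inj₁; inj₂)
import Data.Sum as Sum
open import Data.Unit using (tt)
open import Function using (_∘_)
open import Function.Bundles using (_⇔_; mk⇔; Equivalence)
open import Relation.Nullary using (¬_; Dec; yes; no; does; contradiction)
open import Relation.Nullary.Decidable using (dec-true; ¬¬-excluded-middle)
open import Relation.Binary.PropositionalEquality using (_≡_; _≢_; refl; sym; trans; cong; cong₂; subst; module ≡-Reasoning)

map-unique : ∀ {A B : Set} (f : A → B) {xs : List A}
  → (∀ {x y} → x ∈ₗ xs → y ∈ₗ xs → f x ≡ f y → x ≡ y)
  → Unique xs → Unique (map f xs)
map-unique f inj [] = []
map-unique f inj (x∉xs ∷ u) =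
  All.map⁺ (All.tabulate λ y∈xs fx≡fy → All.lookup x∉xs y∈xs (inj (here refl) (there y∈xs) fx≡fy))
  ∷ map-unique f (λ p q → inj (there p) (there q)) u

concatMap-unique : ∀ {A B : Set} (f : A → List B) {xs : List A}
  → Unique xs
  → (∀ {x} → x ∈ₗ xs → Unique (f x))
  → (∀ {x x' y} → x ∈ₗ xs → x' ∈ₗ xs → y ∈ₗ f x → y ∈ₗ f x' → x ≡ x')
  → Unique (concatMap f xs)
concatMap-unique f [] _ _ = []
concatMap-unique f {x ∷ xs} (x∉xs ∷ u) blocks disjoint =
  ++⁺ (blocks (here refl))
      (concatMap-unique f u (λ p → blocks (there p)) (λ p q → disjoint (there p) (there q)))
      separated
  where
  separated : Disjoint (f x) (concatMap f xs)
  separated (y∈fx , y∈rest) with find (∈-concatMap⁻ f y∈rest)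
  ... | x' , x'∈xs , y∈fx' = All.lookup x∉xs x'∈xs (disjoint (here refl) (there x'∈xs) y∈fx y∈fx')

cartesianProductWith-unique : ∀ {A B C : Set} (g : A → B → C) {xs : List A} {ys : List B}
  → Unique xs → Unique ys
  → (∀ {a a' b b'} → a ∈ₗ xs → a' ∈ₗ xs → b ∈ₗ ys → b' ∈ₗ ys → g a b ≡ g a' b' → a ≡ a' × b ≡ b')
  → Unique (cartesianProductWith g xs ys)
cartesianProductWith-unique g [] _ _ = []
cartesianProductWith-unique g {a ∷ xs} {ys} (a∉xs ∷ u) uys inj =
  ++⁺ (map-unique (g a) (λ p q e → proj₂ (inj (here refl) (here refl) p q e)) uys)
      (cartesianProductWith-unique g u uys (λ p q → inj (there p) (there q)))
      separated
  where
  separated : Disjoint (map (g a) ys) (cartesianProductWith g xs ys)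
  separated (c∈row , c∈rest) with ∈-map⁻ (g a) c∈row | ∈-cartesianProductWith⁻ g xs ys c∈rest
  ... | b , b∈ys , refl | a' , b' , a'∈xs , b'∈ys , e =
    All.lookup a∉xs a'∈xs (proj₁ (inj (here refl) (there a'∈xs) b∈ys b'∈ys e))

length-concatMap : ∀ {A B : Set} (f : A → List B) (k : A → ℕ) (xs : List A)
  → (∀ {x} → x ∈ₗ xs → length (f x) ≡ k x)
  → length (concatMap f xs) ≡ sum (map k xs)
length-concatMap f k [] _ = refl
length-concatMap f k (x ∷ xs) len = begin
  length (f x ++ concatMap f xs)          ≡⟨ length-++ (f x) ⟩
  length (f x) + length (concatMap f xs)  ≡⟨ cong₂ _+_ (len (here refl)) (length-concatMap f k xs (len ∘ there)) ⟩
  k x + sum (map k xs)                    ∎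
  where open ≡-Reasoning

length-cartesianProductWith : ∀ {A B C : Set} (g : A → B → C) (xs : List A) (ys : List B)
  → length (cartesianProductWith g xs ys) ≡ length xs * length ys
length-cartesianProductWith g [] ys = refl
length-cartesianProductWith g (a ∷ xs) ys = begin
  length (map (g a) ys ++ cartesianProductWith g xs ys)          ≡⟨ length-++ (map (g a) ys) ⟩
  length (map (g a) ys) + length (cartesianProductWith g xs ys)  ≡⟨ cong₂ _+_ (length-map (g a) ys) (length-cartesianProductWith g xs ys) ⟩
  length ys + length xs * length ys                              ∎
  where open ≡-Reasoning

Enumerates : ∀ {n} → (Subset n → Set) → ℕ → List (Subset n) → Set
Enumerates P k xs = Unique xs × (∀ S → (S ∈ₗ xs) ⇔ P S) × length xs ≡ k

module Enumeration {n : ℕ} (vs : List (Fin n)) {P : Fin n → Subset n → Set} {k : Fin n → ℕ}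
                   (count : ∀ v → v ∈ₗ vs → NumberOf (P v) (k v)) where
  open DecMembership (_≟_ {n}) using (_∈?_)

  enumeration : Fin n → List (Subset n)
  enumeration v with v ∈? vs
  ... | yes v∈vs = proj₁ (count v v∈vs)
  ... | no _ = []

  enumeration-spec : ∀ {v} → v ∈ₗ vs → Enumerates (P v) (k v) (enumeration v)
  enumeration-spec {v} v∈vs with v ∈? vs
  ... | yes v∈vs' = proj₂ (count v v∈vs')
  ... | no v∉vs = contradiction v∈vs v∉vs

select : ∀ {n} {P : Fin n → Set} → (∀ x → Dec (P x)) → Subset n
select d = tabulate (does ∘ d)

select⁺ : ∀ {n} {P : Fin n → Set} (d : ∀ x → Dec (P x)) {x} → P x → x ∈ₛ select d
select⁺ d {x} px = lookup⇒[]= x (select d) (trans (lookup∘tabulate (does ∘ d) x) (dec-true (d x) px))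

select⁻ : ∀ {n} {P : Fin n → Set} (d : ∀ x → Dec (P x)) {x} → x ∈ₛ select d → P x
select⁻ d {x} x∈ with d x | trans (sym (lookup∘tabulate (does ∘ d) x)) ([]=⇒lookup x∈)
... | yes px | _ = px
... | no _ | ()

¬¬-decidable : ∀ {n} (P : Fin n → Set) → ¬ ¬ (∀ x → Dec (P x))
¬¬-decidable {zero} P k = k λ ()
¬¬-decidable {suc n} P k =
  ¬¬-excluded-middle λ d₀ → ¬¬-decidable (P ∘ suc) λ d → k λ { zero → d₀ ; (suc x) → d x }

MISThrough : ∀ {n} {G : Graph n} → Subgraph G → Fin n → Subset n → Set
MISThrough H v S = IsMaximalIndependent H S × v ∈ₛ S

module _ {n} {G : Graph n} (H : Subgraph G) where

  insert-independent : ∀ {S w} → IsIndependent H S → V H w → (∀ y → y ∈ₛ S → ¬ E H w y)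
    → IsIndependent H (S ∪ ⁅ w ⁆)
  insert-independent {S} {w} (S⊆H , S-indep) w∈H w-free = vertices , edges
    where
    cases : ∀ {x} → x ∈ₛ S ∪ ⁅ w ⁆ → x ∈ₛ S ⊎ x ≡ w
    cases {x} p = Sum.map₂ (x∈⁅y⁆⇒x≡y w) (x∈p∪q⁻ S ⁅ w ⁆ p)
    vertices : ∀ x → x ∈ₛ S ∪ ⁅ w ⁆ → V H x
    vertices x p with cases p
    ... | inj₁ x∈S = S⊆H x x∈S
    ... | inj₂ refl = w∈H
    edges : ∀ a b → a ∈ₛ S ∪ ⁅ w ⁆ → b ∈ₛ S ∪ ⁅ w ⁆ → ¬ E H a b
    edges a b p q e with cases p | cases q
    ... | inj₁ a∈S | inj₁ b∈S = S-indep a b a∈S b∈S e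
    ... | inj₁ a∈S | inj₂ refl = w-free a a∈S (E-sym H e)
    ... | inj₂ refl | inj₁ b∈S = w-free b b∈S e
    ... | inj₂ refl | inj₂ refl = Graph.irrefl G (E⊆Adj H e)

  mis-absorbs : ∀ {S w} → IsMaximalIndependent H S → V H w → (∀ y → y ∈ₛ S → ¬ E H w y) → w ∈ₛ S
  mis-absorbs {S} {w} (indep , maximal) w∈H w-free =
    maximal (S ∪ ⁅ w ⁆) (insert-independent indep w∈H w-free) (p⊆p∪q ⁅ w ⁆) (x∈p∪q⁺ (inj₂ (x∈⁅x⁆ w)))

  mis-dominates : ∀ {S s} → IsMaximalIndependent H S → V H s → ¬ (∀ y → ClosedNbhd H s y → ¬ y ∈ₛ S)
  mis-dominates mis s∈H avoids =
    avoids _ (inj₁ refl) (mis-absorbs mis s∈H λ y y∈S e → avoids y (inj₂ e) y∈S)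

  nbhd⊆maximal-clique : ∀ {K s} → IsMaximalClique H K → K s → IsClique H (ClosedNbhd H s)
    → ClosedNbhd H s ⊆ₚ K
  nbhd⊆maximal-clique {K} {s} ((_ , K-clique) , K-maximal) Ks N-clique =
    K-maximal (ClosedNbhd H s) N-clique K⊆N
    where
    K⊆N : K ⊆ₚ ClosedNbhd H s
    K⊆N x Kx with x ≟ s
    ... | yes x≡s = inj₁ x≡s
    ... | no x≢s = inj₂ (K-clique s x Ks Kx (x≢s ∘ sym))

mis-trace : ∀ {n} {G : Graph n} (A : Subgraph G) {S₁ T w} → IsMaximalIndependent A S₁
  → IsIndependent (whole G) T → S₁ ⊆ₛ T → w ∈ₛ T → V A w → w ∈ₛ S₁
mis-trace A mis (_ , T-indep) S₁⊆T w∈T w∈A =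
  mis-absorbs A mis w∈A λ y y∈S₁ e → T-indep _ y w∈T (S₁⊆T y∈S₁) (E⊆Adj A e)

record Gluing {n} (G : Graph n) (A B : Subgraph G) (K : VPred n) : Set where
  field
    cover    : ∀ x → V A x ⊎ V B x
    split    : ∀ u v → Graph.Adj G u v → E A u v ⊎ E B u v
    K⊆A      : ∀ {x} → K x → V A x
    K⊆B      : ∀ {x} → K x → V B x
    A∩B⊆K    : ∀ {x} → V A x → V B x → K x
    clique-A : ∀ u v → K u → K v → u ≢ v → E A u v
    clique-B : ∀ u v → K u → K v → u ≢ v → E B u v

-- Gluing is symmetric, so every one-sided lemma also holds with A and B exchanged.
swap : ∀ {n} {G : Graph n} {A B K} → Gluing G A B K → Gluing G B A K
swap g = record
  { cover = Sum.swap ∘ cover ; split = λ u v → Sum.swap ∘ split u v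
  ; K⊆A = K⊆B ; K⊆B = K⊆A ; A∩B⊆K = λ b a → A∩B⊆K a b
  ; clique-A = clique-B ; clique-B = clique-A }
  where open Gluing g

module OneSide {n} {G : Graph n} {A B : Subgraph G} {K : VPred n} (g : Gluing G A B K) where
  open Gluing g

  GluedPair : Fin n → Subset n → Subset n → Set
  GluedPair v S₁ S₂ = K v × MISThrough A v S₁ × MISThrough B v S₂

  -- The only vertex of V(A) contributed by S₂ is v, so S₁ is the trace of S₁ ∪ S₂ on V(A).
  union-trace : ∀ {v S₁ S₂ x} → GluedPair v S₁ S₂ → x ∈ₛ S₁ ∪ S₂ → V A x → x ∈ₛ S₁
  union-trace {v} {S₁} {S₂} {x} (Kv , (_ , v∈S₁) , (((S₂⊆B , S₂-indep) , _) , v∈S₂)) x∈ x∈A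
    with x∈p∪q⁻ S₁ S₂ x∈ | x ≟ v
  ... | inj₁ x∈S₁ | _ = x∈S₁
  ... | inj₂ _ | yes refl = v∈S₁
  ... | inj₂ x∈S₂ | no x≢v =
    contradiction (clique-B x v (A∩B⊆K x∈A (S₂⊆B x x∈S₂)) Kv x≢v) (S₂-indep x v x∈S₂ v∈S₂)

  union-meets-K : ∀ {v S₁ S₂ x} → GluedPair v S₁ S₂ → x ∈ₛ S₁ ∪ S₂ → K x → x ≡ v
  union-meets-K {v} {x = x} pair@(Kv , (((_ , S₁-indep) , _) , v∈S₁) , _) x∈ Kx with x ≟ v
  ... | yes x≡v = x≡v
  ... | no x≢v = contradiction (clique-A x v Kx Kv x≢v) (S₁-indep x v (union-trace pair x∈ (K⊆A Kx)) v∈S₁)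

  union-A-independent : ∀ {v S₁ S₂ x y} → GluedPair v S₁ S₂ → x ∈ₛ S₁ ∪ S₂ → y ∈ₛ S₁ ∪ S₂ → ¬ E A x y
  union-A-independent pair@(_ , (((_ , S₁-indep) , _) , _) , _) x∈ y∈ e =
    S₁-indep _ _ (union-trace pair x∈ (proj₁ (E-endpoints A e))) (union-trace pair y∈ (proj₂ (E-endpoints A e))) e

  restriction-maximal : ∀ {S u} → IsMaximalIndependent (whole G) S → u ∈ₛ S → K u
    → (d : ∀ x → Dec (V A x)) → IsMaximalIndependent A (S ∩ select d)
  restriction-maximal {S} {u} mis@((_ , S-indep) , _) u∈S Ku d = (vertices , edges) , maximal
    where
    trace⁺ : ∀ {x} → x ∈ₛ S → V A x → x ∈ₛ S ∩ select d
    trace⁺ x∈S x∈A = x∈p∩q⁺ (x∈S , select⁺ d x∈A)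
    vertices : ∀ x → x ∈ₛ S ∩ select d → V A x
    vertices x p = select⁻ d (proj₂ (x∈p∩q⁻ S _ p))
    edges : ∀ a b → a ∈ₛ S ∩ select d → b ∈ₛ S ∩ select d → ¬ E A a b
    edges a b p q e = S-indep a b (proj₁ (x∈p∩q⁻ S _ p)) (proj₁ (x∈p∩q⁻ S _ q)) (E⊆Adj A e)
    maximal : ∀ T → IsIndependent A T → S ∩ select d ⊆ₛ T → T ⊆ₛ S ∩ select d
    maximal T (T⊆A , T-indep) trace⊆T {w} w∈T = trace⁺ (mis-absorbs (whole G) mis tt w-free) (T⊆A w w∈T)
      where
      -- a neighbour y ∈ S of w across B would put w in K, adjacent in A to u ∈ T
      w-free : ∀ y → y ∈ₛ S → ¬ Graph.Adj G w y
      w-free y y∈S adj with split w y adj | w ≟ u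
      ... | inj₁ e | _ = T-indep w y w∈T (trace⊆T (trace⁺ y∈S (proj₂ (E-endpoints A e)))) e
      ... | inj₂ _ | yes refl = S-indep u y u∈S y∈S adj
      ... | inj₂ e | no w≢u =
        T-indep w u w∈T (trace⊆T (trace⁺ u∈S (K⊆A Ku)))
          (clique-A w u (A∩B⊆K (T⊆A w w∈T) (proj₁ (E-endpoints B e))) Ku w≢u)

module TwoSided {n} {G : Graph n} {A B : Subgraph G} {K : VPred n} (g : Gluing G A B K) where
  open Gluing g
  open OneSide g public using (GluedPair)
  private
    module Aˢ = OneSide g
    module Bˢ = OneSide (swap g)

  flip-pair : ∀ {v S₁ S₂} → GluedPair v S₁ S₂ → Bˢ.GluedPair v S₂ S₁
  flip-pair (Kv , through₁ , through₂) = Kv , through₂ , through₁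

  flip-∪ : ∀ {x} (S₁ S₂ : Subset n) → x ∈ₛ S₁ ∪ S₂ → x ∈ₛ S₂ ∪ S₁
  flip-∪ {x} S₁ S₂ = subst (x ∈ₛ_) (∪-comm S₁ S₂)

  union-maximal : ∀ {v S₁ S₂} → GluedPair v S₁ S₂ → IsMaximalIndependent (whole G) (S₁ ∪ S₂)
  union-maximal {v} {S₁} {S₂} pair@(_ , (mis₁ , _) , (mis₂ , _)) = ((λ _ _ → tt) , edges) , maximal
    where
    edges : ∀ a b → a ∈ₛ S₁ ∪ S₂ → b ∈ₛ S₁ ∪ S₂ → ¬ Graph.Adj G a b
    edges a b p q adj with split a b adj
    ... | inj₁ e = Aˢ.union-A-independent pair p q e
    ... | inj₂ e = Bˢ.union-A-independent (flip-pair pair) (flip-∪ S₁ S₂ p) (flip-∪ S₁ S₂ q) e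
    maximal : ∀ T → IsIndependent (whole G) T → S₁ ∪ S₂ ⊆ₛ T → T ⊆ₛ S₁ ∪ S₂
    maximal T T-indep ∪⊆T {w} w∈T with cover w
    ... | inj₁ w∈A = x∈p∪q⁺ (inj₁ (mis-trace A mis₁ T-indep (∪⊆T ∘ x∈p∪q⁺ ∘ inj₁) w∈T w∈A))
    ... | inj₂ w∈B = x∈p∪q⁺ (inj₂ (mis-trace B mis₂ T-indep (∪⊆T ∘ x∈p∪q⁺ ∘ inj₂) w∈T w∈B))

  union-determines-⊆ : ∀ {v v' S₁ S₂ S₁' S₂'} → GluedPair v S₁ S₂ → GluedPair v' S₁' S₂'
    → S₁ ∪ S₂ ≡ S₁' ∪ S₂' → v ≡ v' × S₁ ⊆ₛ S₁' × S₂ ⊆ₛ S₂'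
  union-determines-⊆ {S₁ = S₁} {S₂} {S₁'} {S₂'} (Kv , (((S₁⊆A , _) , _) , v∈S₁) , (((S₂⊆B , _) , _) , _)) pair' eq =
      Aˢ.union-meets-K pair' (to∪' (x∈p∪q⁺ (inj₁ v∈S₁))) Kv
    , (λ {x} x∈S₁ → Aˢ.union-trace pair' (to∪' (x∈p∪q⁺ (inj₁ x∈S₁))) (S₁⊆A x x∈S₁))
    , (λ {x} x∈S₂ → Bˢ.union-trace (flip-pair pair') (flip-∪ S₁' S₂' (to∪' (x∈p∪q⁺ (inj₂ x∈S₂)))) (S₂⊆B x x∈S₂))
    where
    to∪' : ∀ {x} → x ∈ₛ S₁ ∪ S₂ → x ∈ₛ S₁' ∪ S₂'
    to∪' {x} = subst (x ∈ₛ_) eq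

  union-injective : ∀ {v v' S₁ S₂ S₁' S₂'} → GluedPair v S₁ S₂ → GluedPair v' S₁' S₂'
    → S₁ ∪ S₂ ≡ S₁' ∪ S₂' → v ≡ v' × S₁ ≡ S₁' × S₂ ≡ S₂'
  union-injective pair pair' eq =
    let (v≡v' , S₁⊆S₁' , S₂⊆S₂') = union-determines-⊆ pair pair' eq
        (_ , S₁'⊆S₁ , S₂'⊆S₂) = union-determines-⊆ pair' pair (sym eq)
    in v≡v' , ⊆-antisym S₁⊆S₁' S₁'⊆S₁ , ⊆-antisym S₂⊆S₂' S₂'⊆S₂

  decompose : ∀ {S u} → IsMaximalIndependent (whole G) S → u ∈ₛ S → K u
    → (d₁ : ∀ x → Dec (V A x)) (d₂ : ∀ x → Dec (V B x))
    → GluedPair u (S ∩ select d₁) (S ∩ select d₂) × S ≡ (S ∩ select d₁) ∪ (S ∩ select d₂)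
  decompose {S} {u} mis u∈S Ku d₁ d₂ =
      (Ku , (Aˢ.restriction-maximal mis u∈S Ku d₁ , x∈p∩q⁺ (u∈S , select⁺ d₁ (K⊆A Ku)))
          , (Bˢ.restriction-maximal mis u∈S Ku d₂ , x∈p∩q⁺ (u∈S , select⁺ d₂ (K⊆B Ku))))
    , (begin
        S                                   ≡⟨ sym (∩-identityʳ S) ⟩
        S ∩ ⊤                               ≡⟨ cong (S ∩_) (sym covers) ⟩
        S ∩ (select d₁ ∪ select d₂)         ≡⟨ ∩-distribˡ-∪ S (select d₁) (select d₂) ⟩
        (S ∩ select d₁) ∪ (S ∩ select d₂)   ∎)
    where
    open ≡-Reasoning
    covers : select d₁ ∪ select d₂ ≡ ⊤
    covers = ⊆-antisym ⊆⊤ λ {x} _ → x∈p∪q⁺ (Sum.map (select⁺ d₁) (select⁺ d₂) (cover x))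

module _ {n} {G : Graph n} (G₁ G₂ : Subgraph G) (scs : IsSCS G G₁ G₂) where
  private
    K : VPred n
    K = Inter G₁ G₂

  scs-gluing : Gluing G G₁ G₂ K
  scs-gluing = record
    { cover = cover ; split = λ u v → Equivalence.to (adj⇔ u v)
    ; K⊆A = proj₁ ; K⊆B = proj₂ ; A∩B⊆K = _,_
    ; clique-A = proj₂ (proj₁ (proj₁ in-G₁)) ; clique-B = proj₂ (proj₁ (proj₁ in-G₂)) }
    where
    cover = proj₁ (proj₂ (proj₂ scs))
    adj⇔ = proj₁ (proj₂ (proj₂ (proj₂ scs)))
    in-G₁ = proj₁ (proj₂ (proj₂ (proj₂ (proj₂ scs))))
    in-G₂ = proj₁ (proj₂ (proj₂ (proj₂ (proj₂ (proj₂ scs)))))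

  scs-simplicial-vertex : Σ (Fin n) (λ s → ClosedNbhd (whole G) s ⊆ₚ K)
  scs-simplicial-vertex =
    let (K-maximal , s , Ks , _ , s-maximal) = proj₂ (proj₂ (proj₂ (proj₂ (proj₂ (proj₂ scs)))))
    in s , nbhd⊆maximal-clique (whole G) K-maximal Ks (proj₁ s-maximal)

mis-meets : ∀ {n} {G : Graph n} {K : VPred n} (vs : List (Fin n)) → (∀ x → K x → x ∈ₗ vs)
  → Σ (Fin n) (λ s → ClosedNbhd (whole G) s ⊆ₚ K)
  → ∀ {S} → IsMaximalIndependent (whole G) S → Σ (Fin n) (λ u → u ∈ₗ vs × u ∈ₛ S)
mis-meets {G = G} vs K⊆vs (s , N⊆K) {S} mis with any? (_∈ₛ? S) vs
... | yes some = find some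
... | no none = contradiction (λ y y∈N y∈S → none (lose (K⊆vs y (N⊆K y y∈N)) y∈S))
                              (mis-dominates (whole G) mis tt)

module Counting {n} {G : Graph n} (G₁ G₂ : Subgraph G) (scs : IsSCS G G₁ G₂)
  (vs : List (Fin n)) (vs-unique : Unique vs) (vs-lists : ∀ x → (x ∈ₗ vs) ⇔ Inter G₁ G₂ x)
  (l m : Fin n → ℕ)
  (count₁ : ∀ v → v ∈ₗ vs → NumMISContaining G₁ v (l v))
  (count₂ : ∀ v → v ∈ₗ vs → NumMISContaining G₂ v (m v)) where
  open TwoSided (scs-gluing G₁ G₂ scs)
  open Enumeration vs count₁ using () renaming (enumeration to L₁; enumeration-spec to L₁-spec)
  open Enumeration vs count₂ using () renaming (enumeration to L₂; enumeration-spec to L₂-spec)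

  _≟ₛ_ : (S T : Subset n) → Dec (S ≡ T)
  _≟ₛ_ = ≡-dec Bool._≟_
  open DecMembership _≟ₛ_ using (_∈?_)

  unions : Fin n → List (Subset n)
  unions v = cartesianProductWith _∪_ (L₁ v) (L₂ v)

  misList : List (Subset n)
  misList = concatMap unions vs

  glued : ∀ {v S₁ S₂} → v ∈ₗ vs → S₁ ∈ₗ L₁ v → S₂ ∈ₗ L₂ v → GluedPair v S₁ S₂
  glued {v} {S₁} {S₂} v∈vs S₁∈ S₂∈ =
      Equivalence.to (vs-lists v) v∈vs
    , Equivalence.to (proj₁ (proj₂ (L₁-spec v∈vs)) S₁) S₁∈
    , Equivalence.to (proj₁ (proj₂ (L₂-spec v∈vs)) S₂) S₂∈

  unions⁻ : ∀ {v S} → v ∈ₗ vs → S ∈ₗ unions v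
    → Σ (Subset n) λ S₁ → Σ (Subset n) λ S₂ → GluedPair v S₁ S₂ × S ≡ S₁ ∪ S₂
  unions⁻ {v} v∈vs S∈ =
    let (S₁ , S₂ , S₁∈ , S₂∈ , S≡) = ∈-cartesianProductWith⁻ _∪_ (L₁ v) (L₂ v) S∈
    in S₁ , S₂ , glued v∈vs S₁∈ S₂∈ , S≡

  misList-sound : ∀ {S} → S ∈ₗ misList → IsMaximalIndependent (whole G) S
  misList-sound S∈ with find (∈-concatMap⁻ unions S∈)
  ... | v , v∈vs , S∈unions with unions⁻ v∈vs S∈unions
  ... | _ , _ , pair , refl = union-maximal pair

  misList-complete-dec : ∀ {S} → IsMaximalIndependent (whole G) S
    → (∀ x → Dec (V G₁ x)) → (∀ x → Dec (V G₂ x)) → S ∈ₗ misList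
  misList-complete-dec {S} mis d₁ d₂ =
    let (u , u∈vs , u∈S) = mis-meets {G = G} {K = Inter G₁ G₂} vs (λ x → Equivalence.from (vs-lists x)) (scs-simplicial-vertex G₁ G₂ scs) mis
        Ku = Equivalence.to (vs-lists u) u∈vs
        ((_ , through₁ , through₂) , S≡) = decompose mis u∈S Ku d₁ d₂
        S₁∈ = Equivalence.from (proj₁ (proj₂ (L₁-spec u∈vs)) _) through₁
        S₂∈ = Equivalence.from (proj₁ (proj₂ (L₂-spec u∈vs)) _) through₂
    in ∈-concatMap⁺ unions (lose u∈vs (subst (_∈ₗ unions u) (sym S≡) (∈-cartesianProductWith⁺ _∪_ S₁∈ S₂∈)))

  -- Membership in the list is decidable, so double-negated decidability suffices.
  misList-complete : ∀ {S} → IsMaximalIndependent (whole G) S → S ∈ₗ misList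
  misList-complete {S} mis with S ∈? misList
  ... | yes S∈ = S∈
  ... | no S∉ = contradiction (λ d₁ → ¬¬-decidable (V G₂) λ d₂ → S∉ (misList-complete-dec mis d₁ d₂))
                              (¬¬-decidable (V G₁))

  -- No MIS is listed twice, since a glued pair is determined by its union.
  misList-unique : Unique misList
  misList-unique = concatMap-unique unions vs-unique unions-unique unions-disjoint
    where
    unions-unique : ∀ {v} → v ∈ₗ vs → Unique (unions v)
    unions-unique v∈vs = cartesianProductWith-unique _∪_ (proj₁ (L₁-spec v∈vs)) (proj₁ (L₂-spec v∈vs))
      λ S₁∈ S₁'∈ S₂∈ S₂'∈ eq → proj₂ (union-injective (glued v∈vs S₁∈ S₂∈) (glued v∈vs S₁'∈ S₂'∈) eq)
    unions-disjoint : ∀ {v v' S} → v ∈ₗ vs → v' ∈ₗ vs → S ∈ₗ unions v → S ∈ₗ unions v' → v ≡ v'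
    unions-disjoint v∈vs v'∈vs S∈ S∈' with unions⁻ v∈vs S∈ | unions⁻ v'∈vs S∈'
    ... | _ , _ , pair , S≡ | _ , _ , pair' , S≡' = proj₁ (union-injective pair pair' (trans (sym S≡) S≡'))

  misList-length : length misList ≡ sum (map (λ v → l v * m v) vs)
  misList-length = length-concatMap unions (λ v → l v * m v) vs λ {v} v∈vs → begin
    length (unions v)             ≡⟨ length-cartesianProductWith _∪_ (L₁ v) (L₂ v) ⟩
    length (L₁ v) * length (L₂ v) ≡⟨ cong₂ _*_ (proj₂ (proj₂ (L₁-spec v∈vs))) (proj₂ (proj₂ (L₂-spec v∈vs))) ⟩
    l v * m v                     ∎
    where open ≡-Reasoning

-- Theorem: the simplicial clique sum 𝒢 of G₁ and G₂ has Σ_{v ∈ V(G₁) ∩ V(G₂)} l_v m_v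
-- maximal independent sets.
mainTheorem5 : ∀ {n} (G : Graph n) (G₁ G₂ : Subgraph G)
    → Connected (whole G) → Connected G₁ → Connected G₂
    → IsSCS G G₁ G₂
    → (vs : List (Fin n)) → Unique vs → (∀ x → (x ∈ₗ vs) ⇔ Inter G₁ G₂ x)
    → (l m : Fin n → ℕ)
    → (∀ v → v ∈ₗ vs → NumMISContaining G₁ v (l v))
    → (∀ v → v ∈ₗ vs → NumMISContaining G₂ v (m v))
    → NumMIS (whole G) (sum (map (λ v → l v * m v) vs))
mainTheorem5 G G₁ G₂ _ _ _ scs vs vs-unique vs-lists l m count₁ count₂ =
  misList , misList-unique , (λ S → mk⇔ misList-sound misList-complete) , misList-length
  where open Counting G₁ G₂ scs vs vs-unique vs-lists l m count₁ count₂
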